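{- Let $P$ and $Q$ be natural posets. A down-set $\mathcal{I}$ of $\mathrm{Pro}(P,Q)$ is clopen (both closed and open) if and only if there are finitely many large profunctors $f_1,\dots,f_n$ such that $\mathcal{I}=\bigcup_{i=1}^n U(\mathbf{0},f_i)$, where $U(\mathbf{0},f_i)=\{g\in\mathrm{Pro}(P,Q): g\le f_i\}$. Equivalently, an open down-set is clopen if and only if it is finitely generated.
   Context: A poset is natural if every antichain is finite, every descending chain stabilizes, and for every $p$ the set $\{p'\,:\,p'\le p\}$ is finite. $\widehat{Q}$ is the set of down-sets of $Q$ ordered by inclusion. A profunctor $f:P\to Q$ is an order-preserving map $f:P\to\widehat{Q}$; $\mathrm{Pro}(P,Q)$ is ordered pointwise by inclusion; $\mathbf{0}$ is the profunctor with $\mathbf{0}(p)=\emptyset$ for all $p$. $f$ is large if $\{p: f(p)\neq Q\}$ is finite, and small if $\bigcup_p f(p)$ is finite. The topology on $\mathrm{Pro}(P,Q)$ has as basis the sets $U(g,h)=\{f: g\le f\le h\}$ with $g$ small and $h$ large. -}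

module Defs where

open import Level using (Level; 0ℓ) renaming (suc to lsuc)
open import Data.Nat using (ℕ; suc) renaming (_≤_ to _≤ℕ_)
open import Data.Fin using (Fin)
open import Data.List using (List)
open import Data.List.Relation.Unary.Any using (Any)
open import Data.Product using (Σ; ∃; ∃-syntax; _×_)
open import Data.Empty using (⊥)
open import Relation.Nullary using (¬_)
open import Relation.Unary using (Pred; _⊆_)
open import Relation.Binary.Bundles using (Poset)

module _ {A : Set} (_≈_ : A → A → Set) where
  FiniteSubset : Pred A 0ℓ → Set
  FiniteSubset S = ∃[ xs ] (∀ x → S x → Any (x ≈_) xs)

module _ (P : Poset 0ℓ 0ℓ 0ℓ) where
  open Poset P

  IsAntichain : Pred Carrier 0ℓ → Set
  IsAntichain S = ∀ x y → S x → S y → x ≤ y → x ≈ y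

  record Natural : Set₁ where
    field
      antichainsFinite : ∀ (S : Pred Carrier 0ℓ) → IsAntichain S → FiniteSubset _≈_ S
      descendingStabilizes : ∀ (c : ℕ → Carrier) → (∀ n → c (suc n) ≤ c n) →
                             ∃[ N ] (∀ n → N ≤ℕ n → c n ≈ c N)
      downClosureFinite : ∀ p → FiniteSubset _≈_ (λ p' → p' ≤ p)

  record DownSet : Set₁ where
    field
      mem : Pred Carrier 0ℓ
      downClosed : ∀ {x y} → y ≤ x → mem x → mem y
  open DownSet public

  _⊑_ : DownSet → DownSet → Set
  D ⊑ E = mem D ⊆ mem E

module _ (P Q : Poset 0ℓ 0ℓ 0ℓ) where
  private
    module P = Poset P
    module Q = Poset Q

  record Pro : Set₁ where
    field
      app : P.Carrier → DownSet Q
      mono : ∀ {p p'} → p P.≤ p' → _⊑_ Q (app p) (app p')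
  open Pro public

  _≤Pro_ : Pro → Pro → Set
  f ≤Pro g = ∀ p → _⊑_ Q (app f p) (app g p)

  𝟎 : Pro
  𝟎 = record { app = λ _ → record { mem = λ _ → ⊥ ; downClosed = λ _ () }
             ; mono = λ _ () }

  Large : Pro → Set
  Large f = FiniteSubset P._≈_ (λ p → ¬ (∀ q → mem (app f p) q))

  Small : Pro → Set
  Small f = FiniteSubset Q._≈_ (λ q → ∃[ p ] mem (app f p) q)

  U : Pro → Pro → Pred Pro 0ℓ
  U g h f = g ≤Pro f × f ≤Pro h

  IsOpen : Pred Pro 0ℓ → Set₁
  IsOpen 𝓘 = ∀ f → 𝓘 f →
    Σ Pro λ g → Σ Pro λ h → Small g × Large h × U g h f × (U g h ⊆ 𝓘)

  IsClosed : Pred Pro 0ℓ → Set₁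
  IsClosed 𝓘 = IsOpen (λ f → ¬ 𝓘 f)

  IsDownSetPro : Pred Pro 0ℓ → Set₁
  IsDownSetPro 𝓘 = ∀ f g → f ≤Pro g → 𝓘 g → 𝓘 f

  FinGenByLarge : Pred Pro 0ℓ → Set₁
  FinGenByLarge 𝓘 = Σ ℕ λ n → Σ (Fin n → Pro) λ fs →
    (∀ i → Large (fs i)) × (∀ g → (𝓘 g → ∃[ i ] U 𝟎 (fs i) g) × (∃[ i ] U 𝟎 (fs i) g → 𝓘 g))

{-# OPTIONS --safe #-}
module Submission where

open import Defs
open import Level using (0ℓ)
import Level
open import Data.Product using (_×_)
open import Relation.Unary using (Pred)
open import Relation.Binary.Bundles using (Poset)
open import Axiom.ExcludedMiddle using (ExcludedMiddle)

open import Function using (_∘_; id)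
open import Data.Product using (_,_; proj₁; proj₂; Σ-syntax; ∃; ∃-syntax)
open import Data.Bool using (Bool; true; false)
open import Data.Unit using (⊤; tt)
open import Data.Empty using (⊥-elim)
open import Data.Nat as Nat using (ℕ; zero; suc; _⊔_)
open import Data.Nat.Properties using (≤-refl; ≤-trans; ≤-pred; ≤⇒≤′; m≤m⊔n; m≤n⊔m)
open import Data.List using (List; []; _∷_; _++_; length; filter; map; concatMap; cartesianProduct; tabulate; lookup)
open import Data.List.Properties using (filter-notAll)
open import Data.List.Relation.Unary.Any as Any using (Any; here; there)
open import Data.List.Relation.Unary.Any.Properties as Any using (lookup-index)
open import Data.List.Relation.Unary.All as All using (All; []; _∷_)
open import Data.List.Relation.Unary.All.Properties as All using (all-filter)
open import Data.List.Membership.Propositional using (_∈_; find; lose)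
open import Data.List.Membership.Propositional.Properties using (∈-filter⁺; ∈-cartesianProduct⁺; ∈-lookup)
import Data.List.Membership.Setoid.Properties as Setoidᴹ
open import Data.List.Relation.Binary.Subset.Propositional using (_⊆_)
open import Relation.Nullary using (¬_; yes; no; ¬?)
open import Relation.Nullary.Decidable using (decidable-stable)
open import Relation.Binary using (Rel)
import Relation.Binary.PropositionalEquality as ≡

-- A finitely generated down-set ⋃ U(𝟎, fᵢ) is open, and its complement
-- is open because a profunctor f outside it has, for each i, a point of f not in fᵢ;
-- the small profunctor generated by these points is below f and below no fᵢ.
-- Conversely, call a finite list of sign constraints on points of P × Q covered
-- when the members of 𝓘 satisfying it are dominated by finitely many large members
-- of 𝓘. If the empty list were not covered, then, since points can be enumerated
-- (natural posets are countable), a König-style argument yields an infinite branch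
-- of uncovered constraint lists deciding every point, whose positive part is a
-- profunctor f. If f ∈ 𝓘, openness gives a large h ∈ 𝓘 above f, and the finitely
-- many minimal points outside h are eventually decided negatively, so h covers a
-- stage of the branch. If f ∉ 𝓘, closedness gives a small g below f with
-- U(g, h) ∩ 𝓘 = ∅, and the finitely many generators of g are eventually decided
-- positively, so no member of 𝓘 satisfies that stage. Either way some stage is
-- covered, a contradiction.

uniform-bound : {X : Set} (R : ℕ → Pred X 0ℓ) → (∀ {m n x} → m Nat.≤ n → R m x → R n x) →
                ∀ {xs} → All (λ x → ∃[ n ] R n x) xs → ∃[ N ] All (R N) xs
uniform-bound R mono [] = 0 , []
uniform-bound R mono ((n , r) ∷ rs) =
  let N , rs′ = uniform-bound R mono rs
  in n ⊔ N , mono (m≤m⊔n n N) r ∷ All.map (mono (m≤n⊔m n N)) rs′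

module NaturalPoset (em : ExcludedMiddle 0ℓ) (P : Poset 0ℓ 0ℓ 0ℓ) (natural : Natural P) where
  open Poset P
  open Natural natural

  infix 4 _<_
  _<_ : Rel Carrier 0ℓ
  x < y = x ≤ y × ¬ x ≈ y

  -- Induction along < with a rank bounded by the size of the (finite) down-closure.
  ranked-induction : (R : ℕ → Pred Carrier 0ℓ) →
                     (∀ n p → (∀ q → q < p → R n q) → R (suc n) p) →
                     ∀ p → ∃[ n ] R n p
  ranked-induction R step p =
    let D , covers = downClosureFinite p in length D , go (length D) covers ≤-refl
    where
    go : ∀ n {p D} → (∀ x → x ≤ p → Any (x ≈_) D) → length D Nat.≤ n → R n p
    go zero {p} {[]} covers _ with covers p refl
    ... | ()
    go (suc n) {p} {D} covers |D|≤1+n = step n p below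
      where
      below : ∀ q → q < p → R n q
      below q (q≤p , q≉p) = go n covers′ (≤-pred (≤-trans shorter |D|≤1+n))
        where
        D′ : List Carrier
        D′ = filter (λ y → ¬? (em {y ≈ p})) D

        covers′ : ∀ x → x ≤ q → Any (x ≈_) D′
        covers′ x x≤q =
          Setoidᴹ.∈-filter⁺ Eq.setoid (λ y → ¬? (em {y ≈ p}))
            (λ x≈y x≉p y≈p → x≉p (Eq.trans x≈y y≈p))
            (covers x (trans x≤q q≤p))
            (λ x≈p → q≉p (antisym q≤p (trans (reflexive (Eq.sym x≈p)) x≤q)))

        shorter : length D′ Nat.< length D
        shorter = filter-notAll (λ y → ¬? (em {y ≈ p})) D
                    (Any.map (λ p≈y y≉p → y≉p (Eq.sym p≈y)) (covers p refl))

  Minimal : Pred Carrier 0ℓ → Pred Carrier 0ℓ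
  Minimal V m = V m × (∀ {y} → V y → y ≤ m → y ≈ m)

  minimal-antichain : ∀ V → IsAntichain P (Minimal V)
  minimal-antichain V x y (Vx , _) (_ , y-min) x≤y = y-min Vx x≤y

  minimals : Pred Carrier 0ℓ → List Carrier
  minimals V = proj₁ (antichainsFinite (Minimal V) (minimal-antichain V))

  minimals-complete : ∀ V {m} → Minimal V m → Any (m ≈_) (minimals V)
  minimals-complete V {m} = proj₂ (antichainsFinite (Minimal V) (minimal-antichain V)) m

  minimal-below : ∀ V {v} → V v → ∃[ m ] Minimal V m × m ≤ v
  minimal-below V {v} = proj₂ (ranked-induction (λ _ v → V v → ∃[ m ] Minimal V m × m ≤ v) step v)
    where
    step : ∀ n p → (∀ q → q < p → V q → ∃[ m ] Minimal V m × m ≤ q) →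
           V p → ∃[ m ] Minimal V m × m ≤ p
    step _ p below Vp with em {∃[ q ] V q × q < p}
    ... | yes (q , Vq , q<p) = let m , m-min , m≤q = below q q<p Vq in m , m-min , trans m≤q (proj₁ q<p)
    ... | no ∄ = p , (Vp , λ {q} Vq q≤p → decidable-stable em λ q≉p → ∄ (q , Vq , q≤p , q≉p)) , refl

  IsUpperSet : Pred Carrier 0ℓ → Set
  IsUpperSet V = ∀ {x y} → x ≤ y → V x → V y

  generators : Pred Carrier 0ℓ → List Carrier
  generators V = filter (λ x → em {V x}) (minimals V)

  generators-sound : ∀ V → All V (generators V)
  generators-sound V = all-filter (λ x → em {V x}) (minimals V)

  generators-complete : ∀ {V} → IsUpperSet V → ∀ {v} → V v → Any (_≤ v) (generators V)
  generators-complete {V} V-up Vv =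
    let m , m-min , m≤v = minimal-below V Vv
        x , x∈ , m≈x = find (minimals-complete V m-min)
    in lose (∈-filter⁺ (λ x → em {V x}) x∈ (V-up (reflexive m≈x) (proj₁ m-min)))
            (trans (reflexive (Eq.sym m≈x)) m≤v)

  -- layer (suc n) adds the minimal elements not yet listed, so every element of rank n is in layer n.
  layer : ℕ → List Carrier
  layer zero = []
  layer (suc n) = layer n ++ minimals (λ p → ¬ Any (p ≈_) (layer n))

  layer-exhaustive : ∀ p → ∃[ n ] (∀ {m} → n Nat.≤ m → Any (p ≈_) (layer m))
  layer-exhaustive = ranked-induction (λ n p → ∀ {m} → n Nat.≤ m → Any (p ≈_) (layer m)) step
    where
    step : ∀ n p → (∀ q → q < p → ∀ {m} → n Nat.≤ m → Any (q ≈_) (layer m)) →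
           ∀ {m} → suc n Nat.≤ m → Any (p ≈_) (layer m)
    step n p below {suc m} (Nat.s≤s n≤m) with em {Any (p ≈_) (layer m)}
    ... | yes p∈ = Any.++⁺ˡ p∈
    ... | no p∉ = Any.++⁺ʳ (layer m) (minimals-complete _ (p∉ , p-min))
      where
      p-min : ∀ {q} → ¬ Any (q ≈_) (layer m) → q ≤ p → q ≈ p
      p-min {q} q∉ q≤p = decidable-stable em λ q≉p → q∉ (below q (q≤p , q≉p) n≤m)

module Points (P Q : Poset 0ℓ 0ℓ 0ℓ) where
  private
    module P = Poset P
    module Q = Poset Q

  Point : Set
  Point = P.Carrier × Q.Carrier

  -- Profunctors P → Q are exactly the down-sets of Point under ≼, i.e. of Pᵒᵖ × Q.
  infix 4 _≼_ _≤ᴾ_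
  _≼_ : Rel Point 0ℓ
  (p , q) ≼ (p′ , q′) = p′ P.≤ p × q Q.≤ q′

  ≼-refl : ∀ {x} → x ≼ x
  ≼-refl = P.refl , Q.refl

  ≼-trans : ∀ {x y z} → x ≼ y → y ≼ z → x ≼ z
  ≼-trans (p₁≤p₀ , q₀≤q₁) (p₂≤p₁ , q₁≤q₂) = P.trans p₂≤p₁ p₁≤p₀ , Q.trans q₀≤q₁ q₁≤q₂

  Mem : Pro P Q → Pred Point 0ℓ
  Mem f (p , q) = mem (app f p) q

  Mem-≼ : ∀ f {x y} → x ≼ y → Mem f y → Mem f x
  Mem-≼ f {p , q} {p′ , q′} (p′≤p , q≤q′) m = downClosed (app f p) q≤q′ (mono f p′≤p m)

  _≤ᴾ_ : Rel (Pro P Q) 0ℓ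
  f ≤ᴾ g = _≤Pro_ P Q f g

  ≤ᴾ⇒⊆ : ∀ f g → f ≤ᴾ g → ∀ {x} → Mem f x → Mem g x
  ≤ᴾ⇒⊆ f g f≤g {p , q} = f≤g p

  ⊆⇒≤ᴾ : ∀ f g → (∀ {x} → Mem f x → Mem g x) → f ≤ᴾ g
  ⊆⇒≤ᴾ f g f⊆g p = f⊆g

  ≤ᴾ-refl : ∀ {f} → f ≤ᴾ f
  ≤ᴾ-refl p = id

  ≤ᴾ-trans : ∀ {f g h} → f ≤ᴾ g → g ≤ᴾ h → f ≤ᴾ h
  ≤ᴾ-trans f≤g g≤h p = g≤h p ∘ f≤g p

  𝟎-least : ∀ f → 𝟎 P Q ≤ᴾ f
  𝟎-least f p ()

  𝟎-small : Small P Q (𝟎 P Q)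
  𝟎-small = [] , λ _ ()

  𝟏 : Pro P Q
  𝟏 = record { app = λ _ → record { mem = λ _ → ⊤ ; downClosed = λ _ _ → tt } ; mono = λ _ _ → tt }

  𝟏-greatest : ∀ f → f ≤ᴾ 𝟏
  𝟏-greatest f p _ = tt

  𝟏-large : Large P Q 𝟏
  𝟏-large = [] , λ p ¬full → ⊥-elim (¬full λ _ → tt)

  infixr 7 _∧_
  _∧_ : Pro P Q → Pro P Q → Pro P Q
  f ∧ g = record
    { app = λ p → record
      { mem = λ q → Mem f (p , q) × Mem g (p , q)
      ; downClosed = λ q′≤q (fq , gq) → downClosed (app f p) q′≤q fq , downClosed (app g p) q′≤q gq }
    ; mono = λ p≤p′ (fq , gq) → mono f p≤p′ fq , mono g p≤p′ gq }

  ∧-lowerˡ : ∀ f g → f ∧ g ≤ᴾ f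
  ∧-lowerˡ f g p = proj₁

  ∧-lowerʳ : ∀ f g → f ∧ g ≤ᴾ g
  ∧-lowerʳ f g p = proj₂

  ∧-greatest : ∀ {f g h} → h ≤ᴾ f → h ≤ᴾ g → h ≤ᴾ f ∧ g
  ∧-greatest h≤f h≤g p m = h≤f p m , h≤g p m

  ⟨_⟩ : List Point → Pro P Q
  ⟨ L ⟩ = record
    { app = λ p → record
      { mem = λ q → Any ((p , q) ≼_) L
      ; downClosed = λ q′≤q → Any.map (≼-trans (P.refl , q′≤q)) }
    ; mono = λ p≤p′ → Any.map (≼-trans (p≤p′ , Q.refl)) }

  ⟨⟩-least : ∀ {f L} → All (Mem f) L → ⟨ L ⟩ ≤ᴾ f
  ⟨⟩-least {f} {L} L⊆f = ⊆⇒≤ᴾ ⟨ L ⟩ f λ x∈⟨L⟩ →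
    let y , y∈L , x≼y = find x∈⟨L⟩ in Mem-≼ f x≼y (All.lookup L⊆f y∈L)

  GeneratedBy : Pro P Q → List Point → Set
  GeneratedBy f L = All (Mem f) L × (∀ {x} → Mem f x → Any (x ≼_) L)

  CogeneratedBy : Pro P Q → List Point → Set
  CogeneratedBy f L = All (¬_ ∘ Mem f) L × (∀ {x} → ¬ Mem f x → Any (_≼ x) L)

module NaturalProfunctors (em : ExcludedMiddle 0ℓ) (P Q : Poset 0ℓ 0ℓ 0ℓ) where
  open Points P Q
  private
    module P = Poset P
    module Q = Poset Q

  small⇒generated : Natural P → ∀ {g} → Small P Q g → ∃ (GeneratedBy g)
  small⇒generated natP {g} (S , S-covers) = L , sound , complete
    where
    open NaturalPoset em P natP using (IsUpperSet; generators; generators-sound; generators-complete)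

    column : Q.Carrier → Pred P.Carrier 0ℓ
    column q p = Mem g (p , q)

    column-up : ∀ q → IsUpperSet (column q)
    column-up q p≤p′ = mono g p≤p′

    L : List Point
    L = concatMap (λ q → map (_, q) (generators (column q))) S

    sound : All (Mem g) L
    sound = All.concat⁺ (All.map⁺ {xs = S} (All.tabulate λ {q} _ → All.map⁺ (generators-sound (column q))))

    complete : ∀ {x} → Mem g x → Any (x ≼_) L
    complete {p , q} m =
      let q′ , q′∈S , q≈q′ = find (S-covers q (p , m))
          m′ = Mem-≼ g (P.refl , Q.reflexive (Q.Eq.sym q≈q′)) m
      in Any.concat⁺ (Any.map⁺ (lose q′∈S (Any.map⁺
           (Any.map (_, Q.reflexive q≈q′) (generators-complete (column-up q′) m′)))))

  large⇒cogenerated : Natural Q → ∀ {h} → Large P Q h → ∃ (CogeneratedBy h)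
  large⇒cogenerated natQ {h} (F , F-covers) = L , sound , complete
    where
    open NaturalPoset em Q natQ using (IsUpperSet; generators; generators-sound; generators-complete)

    row : P.Carrier → Pred Q.Carrier 0ℓ
    row p q = ¬ Mem h (p , q)

    row-up : ∀ p → IsUpperSet (row p)
    row-up p q≤q′ q∉ q′∈ = q∉ (downClosed (app h p) q≤q′ q′∈)

    L : List Point
    L = concatMap (λ p → map (p ,_) (generators (row p))) F

    sound : All (¬_ ∘ Mem h) L
    sound = All.concat⁺ (All.map⁺ {xs = F} (All.tabulate λ {p} _ → All.map⁺ (generators-sound (row p))))

    complete : ∀ {x} → ¬ Mem h x → Any (_≼ x) L
    complete {p , q} m∉ =
      let p′ , p′∈F , p≈p′ = find (F-covers p λ full → m∉ (full q))
          m′∉ = m∉ ∘ Mem-≼ h (P.reflexive (P.Eq.sym p≈p′) , Q.refl)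
      in Any.concat⁺ (Any.map⁺ (lose p′∈F (Any.map⁺
           (Any.map (P.reflexive p≈p′ ,_) (generators-complete (row-up p′) m′∉)))))

  ⟨⟩-small : Natural Q → ∀ L → Small P Q ⟨ L ⟩
  ⟨⟩-small natQ L = concatMap (below ∘ proj₂) L , covers
    where
    open Natural natQ using (downClosureFinite)

    below : Q.Carrier → List Q.Carrier
    below q = proj₁ (downClosureFinite q)

    covers : ∀ q → ∃[ p ] Any ((p , q) ≼_) L → Any (q Q.≈_) (concatMap (below ∘ proj₂) L)
    covers q (p , x∈⟨L⟩) =
      let (p′ , q′) , y∈L , (_ , q≤q′) = find x∈⟨L⟩
      in Any.concat⁺ (Any.map⁺ (lose y∈L (proj₂ (downClosureFinite q′) q q≤q′)))

module UncoveredBranch {X : Set} (em₁ : ExcludedMiddle (Level.suc 0ℓ))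
  (Covered : List (X × Bool) → Set₁)
  (covered-split : ∀ C x → Covered ((x , true) ∷ C) → Covered ((x , false) ∷ C) → Covered C)
  (enumeration : ℕ → List X) (nil-uncovered : ¬ Covered []) where

  Uncovered : List (X × Bool) → Set₁
  Uncovered C = ¬ Covered C

  extend : ∀ {C} x → Uncovered C → ∃[ b ] Uncovered ((x , b) ∷ C)
  extend {C} x C-uncovered with em₁ {Covered ((x , true) ∷ C)}
  ... | no ¬covered = true , ¬covered
  ... | yes covered = false , λ covered′ → C-uncovered (covered-split C x covered covered′)

  record Extension (C : List (X × Bool)) (xs : List X) : Set₁ where
    field
      constraints : List (X × Bool)
      uncovered : Uncovered constraints
      extends : C ⊆ constraints
      decides : ∀ {x} → x ∈ xs → ∃[ b ] (x , b) ∈ constraints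
  open Extension

  extend-all : ∀ {C} → Uncovered C → ∀ xs → Extension C xs
  extend-all {C} C-uncovered [] = record
    { constraints = C ; uncovered = C-uncovered ; extends = id ; decides = λ () }
  extend-all C-uncovered (x ∷ xs) =
    let b , Cx-uncovered = extend x C-uncovered
        E = extend-all Cx-uncovered xs
    in record
      { constraints = constraints E
      ; uncovered = uncovered E
      ; extends = extends E ∘ there
      ; decides = λ { (here ≡.refl) → b , extends E (here ≡.refl) ; (there x∈) → decides E x∈ } }

  stage : ℕ → Σ[ C ∈ List (X × Bool) ] Uncovered C
  stage zero = [] , nil-uncovered
  stage (suc n) = let E = extend-all (proj₂ (stage n)) (enumeration n) in constraints E , uncovered E

  branch : ℕ → List (X × Bool)
  branch n = proj₁ (stage n)

  branch-uncovered : ∀ n → Uncovered (branch n)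
  branch-uncovered n = proj₂ (stage n)

  branch-mono : ∀ {m n} → m Nat.≤ n → branch m ⊆ branch n
  branch-mono m≤n = go (≤⇒≤′ m≤n)
    where
    go : ∀ {m n} → m Nat.≤′ n → branch m ⊆ branch n
    go Nat.≤′-refl = id
    go (Nat.≤′-step {n} m≤′n) = extends (extend-all (branch-uncovered n) (enumeration n)) ∘ go m≤′n

  branch-decides : ∀ n {x} → x ∈ enumeration n → ∃[ b ] (x , b) ∈ branch (suc n)
  branch-decides n = decides (extend-all (branch-uncovered n) (enumeration n))

module Compactness (em : ExcludedMiddle 0ℓ) (em₁ : ExcludedMiddle (Level.suc 0ℓ))
  (P Q : Poset 0ℓ 0ℓ 0ℓ) (natP : Natural P) (natQ : Natural Q)
  (𝓘 : Pred (Pro P Q) 0ℓ) where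
  open Points P Q
  open NaturalProfunctors em P Q
  private
    module P = Poset P
    module Q = Poset Q
    module NP = NaturalPoset em P natP
    module NQ = NaturalPoset em Q natQ

  Constraint : Set
  Constraint = Point × Bool

  Holds : Pro P Q → Pred Constraint 0ℓ
  Holds f (x , true) = Mem f x
  Holds f (x , false) = ¬ Mem f x

  Covered : List Constraint → Set₁
  Covered C = Σ[ hs ∈ List (Pro P Q) ] All (λ h → Large P Q h × 𝓘 h) hs ×
                (∀ f → 𝓘 f → All (Holds f) C → Any (f ≤ᴾ_) hs)

  covered-split : ∀ C x → Covered ((x , true) ∷ C) → Covered ((x , false) ∷ C) → Covered C
  covered-split C x (hs₁ , ok₁ , covers₁) (hs₂ , ok₂ , covers₂) = hs₁ ++ hs₂ , All.++⁺ ok₁ ok₂ , covers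
    where
    covers : ∀ f → 𝓘 f → All (Holds f) C → Any (f ≤ᴾ_) (hs₁ ++ hs₂)
    covers f f∈𝓘 sat with em {Mem f x}
    ... | yes fx = Any.++⁺ˡ (covers₁ f f∈𝓘 (fx ∷ sat))
    ... | no ¬fx = Any.++⁺ʳ hs₁ (covers₂ f f∈𝓘 (¬fx ∷ sat))

  unsatisfiable⇒covered : ∀ {C} → (∀ f → 𝓘 f → ¬ All (Holds f) C) → Covered C
  unsatisfiable⇒covered unsat = [] , [] , λ f f∈𝓘 sat → ⊥-elim (unsat f f∈𝓘 sat)

  enumeration : ℕ → List Point
  enumeration n = cartesianProduct (NP.layer n) (NQ.layer n)

  module _ (nil-uncovered : ¬ Covered []) where
    open UncoveredBranch em₁ Covered covered-split enumeration nil-uncovered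

    decided : ∀ x → ∃[ n ] ∃[ b ] ∃[ y ] (y , b) ∈ branch n × x ≼ y × y ≼ x
    decided (p , q) =
      let i , p-listed = NP.layer-exhaustive p
          j , q-listed = NQ.layer-exhaustive q
          p′ , p′∈ , p≈p′ = find (p-listed (m≤m⊔n i j))
          q′ , q′∈ , q≈q′ = find (q-listed (m≤n⊔m i j))
          b , decision = branch-decides (i ⊔ j) (∈-cartesianProduct⁺ p′∈ q′∈)
      in suc (i ⊔ j) , b , (p′ , q′) , decision
         , (P.reflexive (P.Eq.sym p≈p′) , Q.reflexive q≈q′)
         , (P.reflexive p≈p′ , Q.reflexive (Q.Eq.sym q≈q′))

    ForcedIn : ℕ → Pred Point 0ℓ
    ForcedIn n x = ∃[ y ] (y , true) ∈ branch n × x ≼ y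

    ForcedOut : ℕ → Pred Point 0ℓ
    ForcedOut n x = ∃[ y ] (y , false) ∈ branch n × y ≼ x

    forcedIn-mono : ∀ {m n x} → m Nat.≤ n → ForcedIn m x → ForcedIn n x
    forcedIn-mono m≤n (y , y∈ , x≼y) = y , branch-mono m≤n y∈ , x≼y

    forcedOut-mono : ∀ {m n x} → m Nat.≤ n → ForcedOut m x → ForcedOut n x
    forcedOut-mono m≤n (y , y∈ , y≼x) = y , branch-mono m≤n y∈ , y≼x

    forcedIn-≼ : ∀ n {x x′} → x ≼ x′ → ForcedIn n x′ → ForcedIn n x
    forcedIn-≼ n x≼x′ (y , y∈ , x′≼y) = y , y∈ , ≼-trans x≼x′ x′≼y

    forcedOut-≼ : ∀ n {x x′} → x′ ≼ x → ForcedOut n x′ → ForcedOut n x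
    forcedOut-≼ n x′≼x (y , y∈ , y≼x′) = y , y∈ , ≼-trans y≼x′ x′≼x

    satisfies-forcedIn : ∀ {f} n {x} → All (Holds f) (branch n) → ForcedIn n x → Mem f x
    satisfies-forcedIn {f} n sat (y , y∈ , x≼y) = Mem-≼ f x≼y (All.lookup sat y∈)

    satisfies-forcedOut : ∀ {f} n {x} → All (Holds f) (branch n) → ForcedOut n x → ¬ Mem f x
    satisfies-forcedOut {f} n sat (y , y∈ , y≼x) fx = All.lookup sat y∈ (Mem-≼ f y≼x fx)

    limit : Pro P Q
    limit = record
      { app = λ p → record
        { mem = λ q → ∃[ n ] ForcedIn n (p , q)
        ; downClosed = λ q′≤q (n , forced) → n , forcedIn-≼ n (P.refl , q′≤q) forced }
      ; mono = λ p≤p′ (n , forced) → n , forcedIn-≼ n (p≤p′ , Q.refl) forced }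

    limit-forcedOut : ∀ {x} → ¬ Mem limit x → ∃[ n ] ForcedOut n x
    limit-forcedOut {x} x∉ with decided x
    ... | n , true , y , y∈ , x≼y , _ = ⊥-elim (x∉ (n , y , y∈ , x≼y))
    ... | n , false , y , y∈ , _ , y≼x = n , y , y∈ , y≼x

    eventually-below : ∀ {h} → Large P Q h → limit ≤ᴾ h →
                       ∃[ N ] (∀ f → All (Holds f) (branch N) → f ≤ᴾ h)
    eventually-below {h} h-large limit≤h =
      let L , outside , cogenerates = large⇒cogenerated natQ {h} h-large
          N , forced = uniform-bound ForcedOut forcedOut-mono
                         (All.map (λ x∉h → limit-forcedOut (x∉h ∘ ≤ᴾ⇒⊆ limit h limit≤h)) outside)
      in N , λ f sat → ⊆⇒≤ᴾ f h λ fx → decidable-stable em λ x∉h →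
           let y-out , y≼x = All.lookupAny forced (cogenerates x∉h)
           in satisfies-forcedOut N sat (forcedOut-≼ N y≼x y-out) fx

    eventually-above : ∀ {g} → Small P Q g → g ≤ᴾ limit →
                       ∃[ N ] (∀ f → All (Holds f) (branch N) → g ≤ᴾ f)
    eventually-above {g} g-small g≤limit =
      let L , inside , generates = small⇒generated natP {g} g-small
          N , forced = uniform-bound ForcedIn forcedIn-mono
                         (All.map (≤ᴾ⇒⊆ g limit g≤limit) inside)
      in N , λ f sat → ⊆⇒≤ᴾ g f λ gx →
           let y-in , x≼y = All.lookupAny forced (generates gx)
           in satisfies-forcedIn N sat (forcedIn-≼ N x≼y y-in)

    open⇒limit∉ : IsOpen P Q 𝓘 → ¬ 𝓘 limit
    open⇒limit∉ 𝓘-open limit∈𝓘 =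
      let g , h , _ , h-large , (g≤limit , limit≤h) , U⊆𝓘 = 𝓘-open limit limit∈𝓘
          N , below-h = eventually-below {h} h-large limit≤h
          h∈𝓘 = U⊆𝓘 (≤ᴾ-trans {g} {limit} {h} g≤limit limit≤h , ≤ᴾ-refl {h})
      in branch-uncovered N (h ∷ [] , (h-large , h∈𝓘) ∷ [] , λ f _ sat → here (below-h f sat))

    closed⇒limit∈ : IsDownSetPro P Q 𝓘 → IsClosed P Q 𝓘 → ¬ ¬ 𝓘 limit
    closed⇒limit∈ 𝓘-down 𝓘-closed limit∉𝓘 =
      let g , h , g-small , _ , (g≤limit , limit≤h) , U⊆∁𝓘 = 𝓘-closed limit limit∉𝓘
          N , above-g = eventually-above {g} g-small g≤limit
      in branch-uncovered N (unsatisfiable⇒covered λ f f∈𝓘 sat →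
           U⊆∁𝓘 (∧-greatest {f} {h} {g} (above-g f sat) (≤ᴾ-trans {g} {limit} {h} g≤limit limit≤h) , ∧-lowerʳ f h)
                (𝓘-down (f ∧ h) f (∧-lowerˡ f h) f∈𝓘))

  clopen⇒covered : IsDownSetPro P Q 𝓘 → IsOpen P Q 𝓘 → IsClosed P Q 𝓘 → Covered []
  clopen⇒covered 𝓘-down 𝓘-open 𝓘-closed with em₁ {Covered []}
  ... | yes covered = covered
  ... | no uncovered = ⊥-elim (closed⇒limit∈ uncovered 𝓘-down 𝓘-closed (open⇒limit∉ uncovered 𝓘-open))

clopen⇒finitely-generated : ExcludedMiddle 0ℓ → ExcludedMiddle (Level.suc 0ℓ) →
  (P Q : Poset 0ℓ 0ℓ 0ℓ) → Natural P → Natural Q → (𝓘 : Pred (Pro P Q) 0ℓ) →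
  IsDownSetPro P Q 𝓘 → IsOpen P Q 𝓘 → IsClosed P Q 𝓘 → FinGenByLarge P Q 𝓘
clopen⇒finitely-generated em em₁ P Q natP natQ 𝓘 𝓘-down 𝓘-open 𝓘-closed =
  length hs , lookup hs , (λ i → proj₁ (ok i)) , λ g → contained g , (λ (i , _ , g≤) → 𝓘-down g _ g≤ (proj₂ (ok i)))
  where
  open Points P Q
  open Compactness em em₁ P Q natP natQ 𝓘
  covered : Covered []
  covered = clopen⇒covered 𝓘-down 𝓘-open 𝓘-closed
  hs : List (Pro P Q)
  hs = proj₁ covered

  ok : ∀ i → Large P Q (lookup hs i) × 𝓘 (lookup hs i)
  ok i = All.lookup (proj₁ (proj₂ covered)) (∈-lookup i)

  contained : ∀ g → 𝓘 g → ∃[ i ] U P Q (𝟎 P Q) (lookup hs i) g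
  contained g g∈𝓘 = let below = proj₂ (proj₂ covered) g g∈𝓘 [] in
    Any.index below , 𝟎-least g , lookup-index below

finitely-generated⇒open : (P Q : Poset 0ℓ 0ℓ 0ℓ) → ∀ {𝓘} → FinGenByLarge P Q 𝓘 → IsOpen P Q 𝓘
finitely-generated⇒open P Q (_ , fs , large , 𝓘≡) f f∈𝓘 =
  let j , _ , f≤fⱼ = proj₁ (𝓘≡ f) f∈𝓘
  in 𝟎 P Q , fs j , 𝟎-small , large j , (𝟎-least f , f≤fⱼ) ,
     λ {f′} (_ , f′≤fⱼ) → proj₂ (𝓘≡ f′) (j , 𝟎-least f′ , f′≤fⱼ)
  where open Points P Q

finitely-generated⇒closed : ExcludedMiddle 0ℓ → (P Q : Poset 0ℓ 0ℓ 0ℓ) → Natural Q →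
  ∀ {𝓘} → FinGenByLarge P Q 𝓘 → IsClosed P Q 𝓘
finitely-generated⇒closed em P Q natQ (_ , fs , _ , 𝓘≡) f f∉𝓘 =
  ⟨ L ⟩ , 𝟏 , ⟨⟩-small natQ L , 𝟏-large , (⟨⟩-least {f} {L} (All.tabulate⁺ (proj₁ ∘ proj₂ ∘ escape)) , 𝟏-greatest f) ,
  λ {f′} (L≤f′ , _) f′∈𝓘 →
    let j , _ , f′≤fⱼ = proj₁ (𝓘≡ f′) f′∈𝓘
    in proj₂ (proj₂ (escape j)) (≤ᴾ⇒⊆ f′ (fs j) f′≤fⱼ (≤ᴾ⇒⊆ ⟨ L ⟩ f′ L≤f′ (Any.tabulate⁺ j ≼-refl)))
  where
  open Points P Q
  open NaturalProfunctors em P Q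

  escape : ∀ j → ∃[ x ] Mem f x × ¬ Mem (fs j) x
  escape j = decidable-stable em λ ∄ → f∉𝓘 (proj₂ (𝓘≡ f) (j , 𝟎-least f ,
    ⊆⇒≤ᴾ f (fs j) λ fx → decidable-stable em λ x∉fⱼ → ∄ (_ , fx , x∉fⱼ)))

  L : List Point
  L = tabulate (proj₁ ∘ escape)

theorem6p10 : ExcludedMiddle 0ℓ → ExcludedMiddle (Level.suc 0ℓ) →
    (P Q : Poset 0ℓ 0ℓ 0ℓ) → Natural P → Natural Q →
    (𝓘 : Pred (Pro P Q) 0ℓ) → IsDownSetPro P Q 𝓘 →
    ((IsOpen P Q 𝓘 × IsClosed P Q 𝓘 → FinGenByLarge P Q 𝓘) ×
     (FinGenByLarge P Q 𝓘 → IsOpen P Q 𝓘 × IsClosed P Q 𝓘))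
theorem6p10 em em₁ P Q natP natQ 𝓘 𝓘-down =
    (λ (𝓘-open , 𝓘-closed) → clopen⇒finitely-generated em em₁ P Q natP natQ 𝓘 𝓘-down 𝓘-open 𝓘-closed)
  , λ fin-gen → finitely-generated⇒open P Q fin-gen , finitely-generated⇒closed em P Q natQ fin-gen
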